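{- Let $k\ge2$, $n\ge1$, $w\ge1$ be integers and $0\le\Delta\le\frac{n}{2(k-1)}$ a real number. Suppose there is a length-$n$ width-$w$ read-once branching program over alphabet $[k]$ computing $\mathsf{ApproxCount}_{k\text{ -counter}}[n,\Delta]$. Let $m$ be the largest integer with $m\le n-1$ and $\binom{m+k-1}{k-1}\le w$. Then $$\binom{m+k}{k}+(n-m-1)w\ \ge\ \binom{n-2(k-1)\Delta+k-1}{k}.$$
   Context: A length-$n$ read-once branching program (ROBP) over a finite alphabet $\Sigma$ is a directed layered multigraph with layers $V_0,\dots,V_n$, $V_0=\{v_{\mathrm{start}}\}$; for $0\le i\le n-1$ each vertex of $V_i$ has $|\Sigma|$ outgoing edges into $V_{i+1}$ labeled by distinct elements of $\Sigma$; vertices of $V_n$ have no outgoing edges and each is labeled with an output; every vertex is reachable from $v_{\mathrm{start}}$ by some input. An input $x\in\Sigma^n$ follows the path from $v_{\mathrm{start}}$ using at step $i$ the edge labeled $x_i$, and the program outputs the label of the final vertex. The width is $\max_i|V_i|$. For integers $k\ge2$, $n\ge1$ and real $\Delta\ge0$, $\mathsf{ApproxCount}_{k\text{ -counter}}[n,\Delta]$: on input $x\in[k]^n$, output reals $(\hat S_1,\dots,\hat S_k)$ with $|\hat S_j-\#\{i: x_i=j\}|\le\Delta$ for all $j\in[k]$; a program computes it if its output is valid on every input. For real $x$ and integer $j\ge1$, $\binom{x}{j}$ denotes $x(x-1)\cdots(x-j+1)/j!$ (for $x\ge j-1$).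
   Formalization: The parameter Δ and the output estimates $(\hat S_1,\dots,\hat S_k)$ of the branching program are rational rather than real. -}

module Defs where

open import Data.Nat as ℕ using (ℕ; zero; suc; _≤_; _<_)
open import Data.Nat.Properties using (<⇒≤)
open import Data.Fin using (Fin; fromℕ<)
import Data.Fin
open import Data.Fin.Properties using (_≟_)
open import Data.Vec using (Vec; lookup; count)
open import Data.Integer using (+_)
open import Data.Rational using (ℚ; _/_; _*_; _-_; 1ℚ)
open import Data.Product using (Σ; _×_; ∃)
open import Relation.Binary.PropositionalEquality using (_≡_)

ℕ→ℚ : ℕ → ℚ
ℕ→ℚ n = + n / 1

binomℚ : ℚ → ℕ → ℚ
binomℚ x zero = 1ℚ
binomℚ x (suc j) = binomℚ x j * (x - ℕ→ℚ j) * (+ 1 / suc j)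

-- Layer V_i is Fin (layer i); V_0 = Fin 1 = {v_start}; layer (suc i) = size i.
-- Sizes of layers with index > n are irrelevant.
layerOf : (ℕ → ℕ) → ℕ → ℕ
layerOf size zero = 1
layerOf size (suc i) = size i

record ROBP (k n : ℕ) : Set where
  field
    size : ℕ → ℕ
  layer : ℕ → ℕ
  layer = layerOf size
  field
    δ : (i : ℕ) → i < n → Fin (layer i) → Fin k → Fin (layer (suc i))
    out : Fin (layer n) → Fin k → ℚ

  state : Vec (Fin k) n → (i : ℕ) → i ≤ n → Fin (layer i)
  state x zero _ = Data.Fin.zero
  state x (suc i) p = δ i p (state x i (<⇒≤ p)) (lookup x (fromℕ< p))

  run : Vec (Fin k) n → Fin k → ℚ
  run x = out (state x n ℕ.≤-refl)
    where import Data.Nat.Properties as ℕ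

  AllReachable : Set
  AllReachable = (i : ℕ) (p : i ≤ n) (v : Fin (layer i)) →
                 ∃ λ (x : Vec (Fin k) n) → state x i p ≡ v

  HasWidth : ℕ → Set
  HasWidth w = ((i : ℕ) → i ≤ n → layer i ≤ w)
             × (∃ λ i → i ≤ n × layer i ≡ w)

occ : ∀ {k n} → Fin k → Vec (Fin k) n → ℕ
occ j x = count (_≟ j) x

ComputesApproxCount : ∀ {k n} → ROBP k n → ℚ → Set
ComputesApproxCount {k} {n} P Δ =
  (x : Vec (Fin k) n) (j : Fin k) →
  Data.Rational.∣ ROBP.run P x j - ℕ→ℚ (occ j x) ∣ Data.Rational.≤ Δ
  where import Data.Rational

-- Let t = ⌊2Δ⌋. Two inputs reaching the same vertex of layer i have prefix letter counts within t
-- of each other in every coordinate: gluing the prefix of one to the suffix of the other gives an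
-- input with the same output, and counts are integers. Given d ∈ ℕᵏ with |d| + (k-1)t < n, walk
-- from the start vertex, stepping along a letter j that some input reaching the current vertex has
-- used fewer than d_j times. The walk never passes layer |d| + (k-1)t and stops at a vertex v of some
-- layer i where d is the coordinatewise minimum of the prefix counts of the inputs reaching v; thus
-- (i, v) determines d, and |d| ≤ i. Coding d by itself when i ≤ m and by (i, v) otherwise injects the
-- ((N+k) choose k) vectors with |d| ≤ N = n - (k-1)t - 1 into a set of size ((m+k) choose k) +
-- (n-m-1)w, and binom(x, k) is monotone for x ≥ k-1.
module Submission where

open import Defs
open import Data.Nat using (ℕ; _+_; _∸_; _≤_; _*_)
open import Data.Nat.Combinatorics using (_C_)
open import Data.Rational using (ℚ; 0ℚ) renaming (_≤_ to _≤ℚ_; _*_ to _*ℚ_; _+_ to _+ℚ_; _-_ to _-ℚ_)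

open import Data.Nat using (zero; suc; _<_; _/_; _≤′_; ≤′-refl; ≤′-step; z≤n; s≤s)
import Data.Nat.Properties as ℕ
open import Data.Nat.DivMod using (m/n*n≤m; m*n/n≡m; /-monoˡ-≤)
open import Data.Nat.Coprimality as Coprime using (Coprime)
open import Data.Nat.Combinatorics using (nCk+nC[k+1]≡[n+1]C[k+1]; nC1≡n; nCn≡1; k>n⇒nCk≡0)
open import Data.Nat.Tactic.RingSolver using (solve-∀)
import Data.Integer as ℤ
import Data.Integer.Properties as ℤ
open import Data.Rational using (mkℚ; 1ℚ; *≤*; ∣_∣; -_; nonNegative)
import Data.Rational as ℚ
import Data.Rational.Properties as ℚ
open import Data.Rational.Solver using (module +-*-Solver)
open import Data.Fin as Fin using (Fin; toℕ; fromℕ<)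
import Data.Fin.Properties as Fin
open import Data.Vec using (Vec; []; _∷_; lookup; tabulate; replicate)
import Data.Vec.Properties as Vec
open import Data.List as List using (List; map; _++_; length)
import Data.List.Properties as List
open import Data.List.Membership.Propositional using (_∈_)
open import Data.List.Membership.Propositional.Properties using (∈-map⁺; ∈-map⁻; ∈-++⁺ˡ; ∈-++⁺ʳ; ∈-++⁻; ∈-lookup)
import Data.List.Membership.Setoid.Properties as Membership
open import Data.List.Relation.Unary.Any as Any using (here)
import Data.List.Relation.Unary.All as All
open import Data.List.Relation.Unary.AllPairs using ([]; _∷_)
open import Data.List.Relation.Unary.Unique.Propositional using (Unique)
import Data.List.Relation.Unary.Unique.Propositional.Properties as Unique
open import Data.List.Relation.Binary.Disjoint.Propositional using (Disjoint)
open import Algebra.Properties.CommutativeMonoid.Sum ℕ.+-0-commutativeMonoid using (sum; ∑-distrib-+; sum-replicate-zero)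
open import Algebra.Properties.CommutativeSemigroup ℕ.+-commutativeSemigroup using (xy∙z≈xz∙y)
open import Data.Bool using (if_then_else_)
open import Data.Product using (Σ; ∃; _×_; _,_; proj₁; proj₂)
open import Data.Product.Properties using (,-injective)
open import Data.Sum using (_⊎_; inj₁; inj₂)
open import Data.Sum.Properties using (inj₁-injective; inj₂-injective)
open import Data.Sum.Function.Propositional using (_⊎-↔_)
open import Data.Empty using (⊥-elim)
open import Function using (_∘_; case_of_; _↔_; Inverse; Injection)
open import Function.Properties.Inverse using (↔-refl; ↔-sym; ↔-trans; ↔⇒↣)
open import Relation.Binary.PropositionalEquality
open import Relation.Nullary using (Dec; yes; no; does)
open import Relation.Nullary.Decidable using (_×-dec_; dec-true; dec-false)

-- Natural numbers inside ℚ

ℕ→ℚ-≡-mkℚ : ∀ a → ℕ→ℚ a ≡ mkℚ (ℤ.+ a) 0 (Coprime.sym (Coprime.1-coprimeTo a))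
ℕ→ℚ-≡-mkℚ a = ℚ.normalize-coprime _

ℕ→ℚ-≤-mkℚ⁺ : ∀ {c a b} .{cop : Coprime a (suc b)} → c * suc b ≤ a → ℕ→ℚ c ≤ℚ mkℚ (ℤ.+ a) b cop
ℕ→ℚ-≤-mkℚ⁺ {c} {a} {b} c*b≤a rewrite ℕ→ℚ-≡-mkℚ c =
  *≤* (subst₂ ℤ._≤_ (ℤ.pos-* c (suc b)) (sym (ℤ.*-identityʳ (ℤ.+ a))) (ℤ.+≤+ c*b≤a))

ℕ→ℚ-≤-mkℚ⁻ : ∀ {c a b} .{cop : Coprime a (suc b)} → ℕ→ℚ c ≤ℚ mkℚ (ℤ.+ a) b cop → c * suc b ≤ a
ℕ→ℚ-≤-mkℚ⁻ {c} {a} {b} c≤q rewrite ℕ→ℚ-≡-mkℚ c =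
  ℤ.drop‿+≤+ (subst₂ ℤ._≤_ (sym (ℤ.pos-* c (suc b))) (ℤ.*-identityʳ (ℤ.+ a)) (ℚ.drop-*≤* c≤q))

ℕ→ℚ-mono-≤ : ∀ {a b} → a ≤ b → ℕ→ℚ a ≤ℚ ℕ→ℚ b
ℕ→ℚ-mono-≤ {a} {b} a≤b rewrite ℕ→ℚ-≡-mkℚ b = ℕ→ℚ-≤-mkℚ⁺ {a} {b} {0} (subst (_≤ b) (sym (ℕ.*-identityʳ a)) a≤b)

ℕ→ℚ-cancel-≤ : ∀ {a b} → ℕ→ℚ a ≤ℚ ℕ→ℚ b → a ≤ b
ℕ→ℚ-cancel-≤ {a} {b} a≤b rewrite ℕ→ℚ-≡-mkℚ b = subst (_≤ b) (ℕ.*-identityʳ a) (ℕ→ℚ-≤-mkℚ⁻ {a} {b} {0} a≤b)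

ℕ→ℚ-+ : ∀ a b → ℕ→ℚ (a + b) ≡ ℕ→ℚ a +ℚ ℕ→ℚ b
ℕ→ℚ-+ a b rewrite ℕ→ℚ-≡-mkℚ a | ℕ→ℚ-≡-mkℚ b =
  cong (ℚ._/ 1) (trans (ℤ.pos-+ a b) (sym (cong₂ ℤ._+_ (ℤ.*-identityʳ (ℤ.+ a)) (ℤ.*-identityʳ (ℤ.+ b)))))

ℕ→ℚ-* : ∀ a b → ℕ→ℚ (a * b) ≡ ℕ→ℚ a *ℚ ℕ→ℚ b
ℕ→ℚ-* a b rewrite ℕ→ℚ-≡-mkℚ a | ℕ→ℚ-≡-mkℚ b = cong (ℚ._/ 1) (ℤ.pos-* a b)

ℕ→ℚ-∸ : ∀ {a b} → b ≤ a → ℕ→ℚ (a ∸ b) ≡ ℕ→ℚ a -ℚ ℕ→ℚ b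
ℕ→ℚ-∸ {a} {b} b≤a = begin
  ℕ→ℚ (a ∸ b)                          ≡⟨ solve 2 (λ x y → x := x :+ y :- y) refl (ℕ→ℚ (a ∸ b)) (ℕ→ℚ b) ⟩
  ℕ→ℚ (a ∸ b) +ℚ ℕ→ℚ b -ℚ ℕ→ℚ b     ≡⟨ cong (_-ℚ ℕ→ℚ b) (ℕ→ℚ-+ (a ∸ b) b) ⟨
  ℕ→ℚ (a ∸ b + b) -ℚ ℕ→ℚ b            ≡⟨ cong (λ c → ℕ→ℚ c -ℚ ℕ→ℚ b) (ℕ.m∸n+n≡m b≤a) ⟩
  ℕ→ℚ a -ℚ ℕ→ℚ b                      ∎
  where open ≡-Reasoning; open +-*-Solver

record NatFloor (q : ℚ) : Set where
  field
    ⌊q⌋         : ℕ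
    ⌊q⌋≤q       : ℕ→ℚ ⌊q⌋ ≤ℚ q
    ⌊q⌋-maximal : ∀ c → ℕ→ℚ c ≤ℚ q → c ≤ ⌊q⌋

  ≤+⌊q⌋ : ∀ a b → ℕ→ℚ a ≤ℚ ℕ→ℚ b +ℚ q → a ≤ b + ⌊q⌋
  ≤+⌊q⌋ a b a≤b+q with a ℕ.≤? b
  ... | yes a≤b = ℕ.≤-trans a≤b (ℕ.m≤m+n b ⌊q⌋)
  ... | no  a≰b = subst (_≤ b + ⌊q⌋) (ℕ.m+[n∸m]≡n b≤a) (ℕ.+-monoʳ-≤ b (⌊q⌋-maximal (a ∸ b) a∸b≤q))
    where
    open ℚ.≤-Reasoning
    open +-*-Solver
    b≤a = ℕ.<⇒≤ (ℕ.≰⇒> a≰b)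
    a∸b≤q : ℕ→ℚ (a ∸ b) ≤ℚ q
    a∸b≤q = begin
      ℕ→ℚ (a ∸ b)             ≡⟨ ℕ→ℚ-∸ b≤a ⟩
      ℕ→ℚ a -ℚ ℕ→ℚ b         ≤⟨ ℚ.+-monoˡ-≤ (- ℕ→ℚ b) a≤b+q ⟩
      ℕ→ℚ b +ℚ q -ℚ ℕ→ℚ b    ≡⟨ solve 2 (λ b q → b :+ q :- b := q) refl (ℕ→ℚ b) q ⟩
      q                        ∎

natFloor : ∀ q → 0ℚ ≤ℚ q → NatFloor q
natFloor (mkℚ (ℤ.+ a) b _) _ = record
  { ⌊q⌋         = a / suc b
  ; ⌊q⌋≤q       = ℕ→ℚ-≤-mkℚ⁺ {a / suc b} {a} {b} (m/n*n≤m a (suc b))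
  ; ⌊q⌋-maximal = λ c c≤q → subst (_≤ a / suc b) (m*n/n≡m c (suc b)) (/-monoˡ-≤ (suc b) (ℕ→ℚ-≤-mkℚ⁻ {c} {a} {b} c≤q))
  }
natFloor (mkℚ ℤ.-[1+ a ] b _) (*≤* ())

ℕ→ℚ[k*t]≤ℕ→ℚ[2*k]*Δ : ∀ k {t Δ} → ℕ→ℚ t ≤ℚ Δ +ℚ Δ → ℕ→ℚ (k * t) ≤ℚ ℕ→ℚ (2 * k) *ℚ Δ
ℕ→ℚ[k*t]≤ℕ→ℚ[2*k]*Δ k {t} {Δ} t≤2Δ = begin
  ℕ→ℚ (k * t)             ≡⟨ ℕ→ℚ-* k t ⟩
  ℕ→ℚ k *ℚ ℕ→ℚ t         ≤⟨ ℚ.*-monoˡ-≤-nonNeg (ℕ→ℚ k) {{nonNegative (ℕ→ℚ-mono-≤ {0} {k} z≤n)}} t≤2Δ ⟩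
  ℕ→ℚ k *ℚ (Δ +ℚ Δ)      ≡⟨ solve 2 (λ K D → K :* (D :+ D) := (K :+ K) :* D) refl (ℕ→ℚ k) Δ ⟩
  (ℕ→ℚ k +ℚ ℕ→ℚ k) *ℚ Δ ≡⟨ cong (_*ℚ Δ) (ℕ→ℚ-+ k k) ⟨
  ℕ→ℚ (k + k) *ℚ Δ       ≡⟨ cong (λ c → ℕ→ℚ (k + c) *ℚ Δ) (ℕ.+-identityʳ k) ⟨
  ℕ→ℚ (2 * k) *ℚ Δ       ∎
  where
  open ℚ.≤-Reasoning
  open +-*-Solver

p≤∣p∣ : ∀ p → p ≤ℚ ∣ p ∣
p≤∣p∣ (mkℚ (ℤ.+ _) _ _) = ℚ.≤-refl
p≤∣p∣ (mkℚ ℤ.-[1+ _ ] _ _) = *≤* ℤ.-≤+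

∣r-p∣≤Δ⇒∣r-q∣≤Δ⇒q≤p+[Δ+Δ] : ∀ {r p q Δ} → ∣ r -ℚ p ∣ ≤ℚ Δ → ∣ r -ℚ q ∣ ≤ℚ Δ →
                             q ≤ℚ p +ℚ (Δ +ℚ Δ)
∣r-p∣≤Δ⇒∣r-q∣≤Δ⇒q≤p+[Δ+Δ] {r} {p} {q} {Δ} ∣r-p∣≤Δ ∣r-q∣≤Δ = begin
  q                                    ≡⟨ solve 3 (λ r p q → q := p :+ ((r :- p) :+ (:- (r :- q)))) refl r p q ⟩
  p +ℚ ((r -ℚ p) +ℚ (- (r -ℚ q)))     ≤⟨ ℚ.+-monoʳ-≤ p (ℚ.+-mono-≤ r-p≤Δ -[r-q]≤Δ) ⟩
  p +ℚ (Δ +ℚ Δ)                        ∎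
  where
  open ℚ.≤-Reasoning
  open +-*-Solver
  r-p≤Δ : r -ℚ p ≤ℚ Δ
  r-p≤Δ = ℚ.≤-trans (p≤∣p∣ _) ∣r-p∣≤Δ
  -[r-q]≤Δ : - (r -ℚ q) ≤ℚ Δ
  -[r-q]≤Δ = ℚ.≤-trans (p≤∣p∣ _) (subst (_≤ℚ Δ) (sym (ℚ.∣-p∣≡∣p∣ (r -ℚ q))) ∣r-q∣≤Δ)

p≤q⇒0≤q-p : ∀ {p q} → p ≤ℚ q → 0ℚ ≤ℚ q -ℚ p
p≤q⇒0≤q-p {p} {q} p≤q = subst (_≤ℚ q -ℚ p) (ℚ.+-inverseʳ p) (ℚ.+-monoˡ-≤ (- p) p≤q)

*-mono-≤-nonNeg : ∀ {p q r s} → 0ℚ ≤ℚ p → 0ℚ ≤ℚ r → p ≤ℚ q → r ≤ℚ s → p *ℚ r ≤ℚ q *ℚ s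
*-mono-≤-nonNeg {p} {q} {r} {s} 0≤p 0≤r p≤q r≤s =
  ℚ.≤-trans (ℚ.*-monoʳ-≤-nonNeg r {{nonNegative 0≤r}} p≤q)
            (ℚ.*-monoˡ-≤-nonNeg q {{nonNegative (ℚ.≤-trans 0≤p p≤q)}} r≤s)

-- 0ℚ *ℚ 0ℚ computes to 0ℚ.
0≤p*q : ∀ {p q} → 0ℚ ≤ℚ p → 0ℚ ≤ℚ q → 0ℚ ≤ℚ p *ℚ q
0≤p*q = *-mono-≤-nonNeg ℚ.≤-refl ℚ.≤-refl

-- Binomial coefficients

nC[k+1]*[k+1]≡nCk*[n∸k] : ∀ n k → (n C suc k) * suc k ≡ (n C k) * (n ∸ k)
nC[k+1]*[k+1]≡nCk*[n∸k] zero    zero    = refl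
nC[k+1]*[k+1]≡nCk*[n∸k] zero    (suc k) = refl
nC[k+1]*[k+1]≡nCk*[n∸k] (suc n) zero    = trans (ℕ.*-identityʳ (suc n C 1)) (trans (nC1≡n (suc n)) (sym (ℕ.*-identityˡ (suc n))))
nC[k+1]*[k+1]≡nCk*[n∸k] (suc n) (suc k) = begin
  (suc n C suc (suc k)) * suc (suc k)                          ≡⟨ cong (_* suc (suc k)) (nCk+nC[k+1]≡[n+1]C[k+1] n (suc k)) ⟨
  ((n C suc k) + (n C suc (suc k))) * suc (suc k)              ≡⟨ ℕ.*-distribʳ-+ (suc (suc k)) (n C suc k) _ ⟩
  (n C suc k) * suc (suc k) + (n C suc (suc k)) * suc (suc k)  ≡⟨ cong ((n C suc k) * suc (suc k) +_) (nC[k+1]*[k+1]≡nCk*[n∸k] n (suc k)) ⟩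
  (n C suc k) * suc (suc k) + (n C suc k) * (n ∸ suc k)        ≡⟨ shift ⟩
  (n C suc k) * suc k + (n C suc k) * (n ∸ k)                  ≡⟨ cong (_+ (n C suc k) * (n ∸ k)) (nC[k+1]*[k+1]≡nCk*[n∸k] n k) ⟩
  (n C k) * (n ∸ k) + (n C suc k) * (n ∸ k)                    ≡⟨ ℕ.*-distribʳ-+ (n ∸ k) (n C k) _ ⟨
  ((n C k) + (n C suc k)) * (n ∸ k)                            ≡⟨ cong (_* (n ∸ k)) (nCk+nC[k+1]≡[n+1]C[k+1] n k) ⟩
  (suc n C suc k) * (suc n ∸ suc k)                            ∎
  where
  open ≡-Reasoning
  move-one : ∀ c k r → c * suc (suc k) + c * r ≡ c * suc k + c * suc r
  move-one = solve-∀
  shift : (n C suc k) * suc (suc k) + (n C suc k) * (n ∸ suc k) ≡ (n C suc k) * suc k + (n C suc k) * (n ∸ k)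
  shift with suc k ℕ.≤? n
  ... | yes k<n = trans (move-one (n C suc k) k (n ∸ suc k)) (cong (λ r → (n C suc k) * suc k + (n C suc k) * r) (sym (ℕ.+-∸-assoc 1 k<n)))
  ... | no  k≮n rewrite k>n⇒nCk≡0 (ℕ.≰⇒> k≮n) = refl

0≤1/[1+n] : ∀ n → 0ℚ ≤ℚ ℤ.+ 1 ℚ./ suc n
0≤1/[1+n] n rewrite ℚ.normalize-coprime {1} {n} (Coprime.1-coprimeTo (suc n)) = *≤* (ℤ.+≤+ z≤n)

[1+n]*1/[1+n]≡1 : ∀ n → ℕ→ℚ (suc n) *ℚ (ℤ.+ 1 ℚ./ suc n) ≡ 1ℚ
[1+n]*1/[1+n]≡1 n rewrite ℕ→ℚ-≡-mkℚ (suc n) | ℚ.normalize-coprime {1} {n} (Coprime.1-coprimeTo (suc n)) =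
  ℚ.*-inverseʳ (mkℚ (ℤ.+ suc n) 0 (Coprime.sym (Coprime.1-coprimeTo (suc n))))

binomℚ-ℕ→ℚ : ∀ a j → binomℚ (ℕ→ℚ a) j ≡ ℕ→ℚ (a C j)
binomℚ-ℕ→ℚ a zero = refl
binomℚ-ℕ→ℚ a (suc j) with j ℕ.≤? a
... | yes j≤a = begin
  binomℚ (ℕ→ℚ a) j *ℚ (ℕ→ℚ a -ℚ ℕ→ℚ j) *ℚ r   ≡⟨ cong₂ (λ b c → b *ℚ c *ℚ r) (binomℚ-ℕ→ℚ a j) (sym (ℕ→ℚ-∸ j≤a)) ⟩
  ℕ→ℚ (a C j) *ℚ ℕ→ℚ (a ∸ j) *ℚ r              ≡⟨ cong (_*ℚ r) (ℕ→ℚ-* (a C j) (a ∸ j)) ⟨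
  ℕ→ℚ ((a C j) * (a ∸ j)) *ℚ r                  ≡⟨ cong (λ c → ℕ→ℚ c *ℚ r) (nC[k+1]*[k+1]≡nCk*[n∸k] a j) ⟨
  ℕ→ℚ ((a C suc j) * suc j) *ℚ r                ≡⟨ cong (_*ℚ r) (ℕ→ℚ-* (a C suc j) (suc j)) ⟩
  ℕ→ℚ (a C suc j) *ℚ ℕ→ℚ (suc j) *ℚ r          ≡⟨ ℚ.*-assoc (ℕ→ℚ (a C suc j)) (ℕ→ℚ (suc j)) r ⟩
  ℕ→ℚ (a C suc j) *ℚ (ℕ→ℚ (suc j) *ℚ r)        ≡⟨ cong (ℕ→ℚ (a C suc j) *ℚ_) ([1+n]*1/[1+n]≡1 j) ⟩
  ℕ→ℚ (a C suc j) *ℚ 1ℚ                         ≡⟨ ℚ.*-identityʳ _ ⟩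
  ℕ→ℚ (a C suc j)                                ∎
  where
  open ≡-Reasoning
  r = ℤ.+ 1 ℚ./ suc j
... | no j≰a rewrite binomℚ-ℕ→ℚ a j | k>n⇒nCk≡0 (ℕ.≰⇒> j≰a) | k>n⇒nCk≡0 (ℕ.m<n⇒m<1+n (ℕ.≰⇒> j≰a)) =
  trans (cong (_*ℚ (ℤ.+ 1 ℚ./ suc j)) (ℚ.*-zeroˡ (ℕ→ℚ a -ℚ ℕ→ℚ j))) (ℚ.*-zeroˡ (ℤ.+ 1 ℚ./ suc j))

binomℚ-nonNeg : ∀ {K x} j → j ≤ suc K → ℕ→ℚ K ≤ℚ x → 0ℚ ≤ℚ binomℚ x j
binomℚ-nonNeg zero    _         _   = *≤* (ℤ.+≤+ z≤n)
binomℚ-nonNeg (suc j) (s≤s j≤K) K≤x =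
  0≤p*q (0≤p*q (binomℚ-nonNeg j (ℕ.m≤n⇒m≤1+n j≤K) K≤x) (p≤q⇒0≤q-p (ℚ.≤-trans (ℕ→ℚ-mono-≤ j≤K) K≤x)))
        (0≤1/[1+n] j)

binomℚ-mono-≤ : ∀ {K x y} j → j ≤ suc K → ℕ→ℚ K ≤ℚ x → x ≤ℚ y → binomℚ x j ≤ℚ binomℚ y j
binomℚ-mono-≤ zero    _         _   _   = ℚ.≤-refl
binomℚ-mono-≤ (suc j) (s≤s j≤K) K≤x x≤y =
  ℚ.*-monoʳ-≤-nonNeg _ {{nonNegative (0≤1/[1+n] j)}}
    (*-mono-≤-nonNeg (binomℚ-nonNeg j (ℕ.m≤n⇒m≤1+n j≤K) K≤x) (p≤q⇒0≤q-p (ℚ.≤-trans (ℕ→ℚ-mono-≤ j≤K) K≤x))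
      (binomℚ-mono-≤ j (ℕ.m≤n⇒m≤1+n j≤K) K≤x x≤y) (ℚ.+-monoˡ-≤ (- ℕ→ℚ j) x≤y))

binomℚ[n-D+K]≤[n∸T+K]C[1+K] : ∀ n K T {D} → ℕ→ℚ T ≤ℚ D → D ≤ℚ ℕ→ℚ n →
                               binomℚ (ℕ→ℚ n -ℚ D +ℚ ℕ→ℚ K) (suc K) ≤ℚ ℕ→ℚ ((n ∸ T + K) C suc K)
binomℚ[n-D+K]≤[n∸T+K]C[1+K] n K T {D} T≤D D≤n = begin
  binomℚ (ℕ→ℚ n -ℚ D +ℚ ℕ→ℚ K) (suc K)  ≤⟨ binomℚ-mono-≤ {K} (suc K) ℕ.≤-refl K≤n-D+K n-D+K≤n∸T+K ⟩
  binomℚ (ℕ→ℚ (n ∸ T + K)) (suc K)      ≡⟨ binomℚ-ℕ→ℚ (n ∸ T + K) (suc K) ⟩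
  ℕ→ℚ ((n ∸ T + K) C suc K)             ∎
  where
  open ℚ.≤-Reasoning
  K≤n-D+K : ℕ→ℚ K ≤ℚ ℕ→ℚ n -ℚ D +ℚ ℕ→ℚ K
  K≤n-D+K = subst (_≤ℚ ℕ→ℚ n -ℚ D +ℚ ℕ→ℚ K) (ℚ.+-identityˡ (ℕ→ℚ K))
                  (ℚ.+-monoˡ-≤ (ℕ→ℚ K) (p≤q⇒0≤q-p D≤n))
  n-D+K≤n∸T+K : ℕ→ℚ n -ℚ D +ℚ ℕ→ℚ K ≤ℚ ℕ→ℚ (n ∸ T + K)
  n-D+K≤n∸T+K = subst (ℕ→ℚ n -ℚ D +ℚ ℕ→ℚ K ≤ℚ_)
    (sym (trans (ℕ→ℚ-+ (n ∸ T) K) (cong (_+ℚ ℕ→ℚ K) (ℕ→ℚ-∸ (ℕ→ℚ-cancel-≤ {T} {n} (ℚ.≤-trans T≤D D≤n))))))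
    (ℚ.+-monoˡ-≤ (ℕ→ℚ K) (ℚ.+-monoʳ-≤ (ℕ→ℚ n) (ℚ.neg-antimono-≤ T≤D)))

lookup-extensionality : ∀ {A : Set} {k} {d d′ : Vec A k} → (∀ j → lookup d j ≡ lookup d′ j) → d ≡ d′
lookup-extensionality {d = d} {d′} eq =
  trans (sym (Vec.tabulate∘lookup d)) (trans (Vec.tabulate-cong eq) (Vec.tabulate∘lookup d′))

∃-vec? : ∀ {k m} {Q : Vec (Fin k) m → Set} → (∀ x → Dec (Q x)) → Dec (∃ Q)
∃-vec? {m = zero} Q? with Q? []
... | yes q = yes ([] , q)
... | no ¬q = no λ { ([] , q) → ¬q q }
∃-vec? {m = suc m} Q? with Fin.any? (λ a → ∃-vec? (λ xs → Q? (a ∷ xs)))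
... | yes (a , xs , q) = yes (a ∷ xs , q)
... | no ¬q = no λ { (a ∷ xs , q) → ¬q (a , xs , q) }

sum-mono-≤ : ∀ {k} {f g : Fin k → ℕ} → (∀ j → f j ≤ g j) → sum f ≤ sum g
sum-mono-≤ {zero}  _   = z≤n
sum-mono-≤ {suc k} f≤g = ℕ.+-mono-≤ (f≤g Fin.zero) (sum-mono-≤ (λ j → f≤g (Fin.suc j)))

sum-const : ∀ k t → sum {k} (λ _ → t) ≡ k * t
sum-const zero    t = refl
sum-const (suc k) t = cong (t +_) (sum-const k t)

Fin⊎Fin×Fin↔Fin : ∀ {a b c} → (Fin a ⊎ (Fin b × Fin c)) ↔ Fin (a + b * c)
Fin⊎Fin×Fin↔Fin = ↔-sym (↔-trans Fin.+↔⊎ (↔-refl ⊎-↔ Fin.*↔×))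

-- Vectors of naturals with bounded sum

suc-head : ∀ {k} → Vec ℕ (suc k) → Vec ℕ (suc k)
suc-head (a ∷ v) = suc a ∷ v

vecsOfSum≤ : (k N : ℕ) → List (Vec ℕ k)
vecsOfSum≤ zero    N       = List.[ [] ]
vecsOfSum≤ (suc k) zero    = map (0 ∷_) (vecsOfSum≤ k zero)
vecsOfSum≤ (suc k) (suc N) = map (0 ∷_) (vecsOfSum≤ k (suc N)) ++ map suc-head (vecsOfSum≤ (suc k) N)

length-vecsOfSum≤ : ∀ k N → length (vecsOfSum≤ k N) ≡ (N + k) C k
length-vecsOfSum≤ zero    N       = refl
length-vecsOfSum≤ (suc k) zero    = begin
  length (map (0 ∷_) (vecsOfSum≤ k zero)) ≡⟨ List.length-map (0 ∷_) (vecsOfSum≤ k zero) ⟩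
  length (vecsOfSum≤ k zero)              ≡⟨ length-vecsOfSum≤ k zero ⟩
  k C k                                   ≡⟨ trans (nCn≡1 k) (sym (nCn≡1 (suc k))) ⟩
  suc k C suc k                           ∎
  where open ≡-Reasoning
length-vecsOfSum≤ (suc k) (suc N) = begin
  length (map (0 ∷_) (vecsOfSum≤ k (suc N)) ++ map suc-head (vecsOfSum≤ (suc k) N))
    ≡⟨ List.length-++ (map (0 ∷_) (vecsOfSum≤ k (suc N))) ⟩
  length (map (0 ∷_) (vecsOfSum≤ k (suc N))) + length (map suc-head (vecsOfSum≤ (suc k) N))
    ≡⟨ cong₂ _+_ (List.length-map _ (vecsOfSum≤ k (suc N))) (List.length-map _ (vecsOfSum≤ (suc k) N)) ⟩
  length (vecsOfSum≤ k (suc N)) + length (vecsOfSum≤ (suc k) N)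
    ≡⟨ cong₂ _+_ (length-vecsOfSum≤ k (suc N)) (length-vecsOfSum≤ (suc k) N) ⟩
  (suc N + k) C k + (N + suc k) C suc k
    ≡⟨ cong (λ a → (suc N + k) C k + a C suc k) (ℕ.+-suc N k) ⟩
  (suc N + k) C k + (suc N + k) C suc k
    ≡⟨ nCk+nC[k+1]≡[n+1]C[k+1] (suc N + k) k ⟩
  suc (suc N + k) C suc k
    ≡⟨ cong (λ a → suc a C suc k) (ℕ.+-suc N k) ⟨
  (suc N + suc k) C suc k ∎
  where open ≡-Reasoning

∈-vecsOfSum≤⁻ : ∀ k N {d} → d ∈ vecsOfSum≤ k N → sum (lookup d) ≤ N
∈-vecsOfSum≤⁻ zero    N       (here refl) = z≤n
∈-vecsOfSum≤⁻ (suc k) zero    d∈ with ∈-map⁻ (0 ∷_) d∈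
... | _ , d′∈ , refl = ∈-vecsOfSum≤⁻ k zero d′∈
∈-vecsOfSum≤⁻ (suc k) (suc N) d∈ with ∈-++⁻ (map (0 ∷_) (vecsOfSum≤ k (suc N))) d∈
... | inj₁ d∈ˡ with ∈-map⁻ (0 ∷_) d∈ˡ
...   | _ , d′∈ , refl = ∈-vecsOfSum≤⁻ k (suc N) d′∈
∈-vecsOfSum≤⁻ (suc k) (suc N) d∈ | inj₂ d∈ʳ with ∈-map⁻ suc-head d∈ʳ
...   | _ ∷ _ , d′∈ , refl = s≤s (∈-vecsOfSum≤⁻ (suc k) N d′∈)

∈-vecsOfSum≤⁺ : ∀ k N (d : Vec ℕ k) → sum (lookup d) ≤ N → d ∈ vecsOfSum≤ k N
∈-vecsOfSum≤⁺ zero    N       []          _         = here refl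
∈-vecsOfSum≤⁺ (suc k) zero    (zero ∷ d)  d≤N       = ∈-map⁺ (0 ∷_) (∈-vecsOfSum≤⁺ k zero d d≤N)
∈-vecsOfSum≤⁺ (suc k) (suc N) (zero ∷ d)  d≤N       = ∈-++⁺ˡ (∈-map⁺ (0 ∷_) (∈-vecsOfSum≤⁺ k (suc N) d d≤N))
∈-vecsOfSum≤⁺ (suc k) (suc N) (suc a ∷ d) (s≤s d≤N) =
  ∈-++⁺ʳ (map (0 ∷_) (vecsOfSum≤ k (suc N))) (∈-map⁺ suc-head (∈-vecsOfSum≤⁺ (suc k) N (a ∷ d) d≤N))

vecsOfSum≤-unique : ∀ k N → Unique (vecsOfSum≤ k N)
vecsOfSum≤-unique zero    N       = All.[] ∷ []
vecsOfSum≤-unique (suc k) zero    = Unique.map⁺ Vec.∷-injectiveʳ (vecsOfSum≤-unique k zero)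
vecsOfSum≤-unique (suc k) (suc N) =
  Unique.++⁺ (Unique.map⁺ Vec.∷-injectiveʳ (vecsOfSum≤-unique k (suc N)))
             (Unique.map⁺ suc-head-injective (vecsOfSum≤-unique (suc k) N))
             disjoint
  where
  suc-head-injective : ∀ {u v : Vec ℕ (suc k)} → suc-head u ≡ suc-head v → u ≡ v
  suc-head-injective {_ ∷ _} {_ ∷ _} refl = refl
  disjoint : Disjoint (map (0 ∷_) (vecsOfSum≤ k (suc N))) (map suc-head (vecsOfSum≤ (suc k) N))
  disjoint (d∈ˡ , d∈ʳ) with ∈-map⁻ (0 ∷_) d∈ˡ | ∈-map⁻ suc-head d∈ʳ
  ... | _ , _ , refl | _ ∷ _ , _ , ()

Unique⇒lookup-injective : ∀ {A : Set} {xs : List A} → Unique xs → ∀ {i j} → List.lookup xs i ≡ List.lookup xs j → i ≡ j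
Unique⇒lookup-injective (_ ∷ _)    {Fin.zero}  {Fin.zero}  _  = refl
Unique⇒lookup-injective (x∉ ∷ _)   {Fin.zero}  {Fin.suc j} eq = ⊥-elim (All.lookup x∉ (∈-lookup j) eq)
Unique⇒lookup-injective (x∉ ∷ _)   {Fin.suc i} {Fin.zero}  eq = ⊥-elim (All.lookup x∉ (∈-lookup i) (sym eq))
Unique⇒lookup-injective (_ ∷ uniq) {Fin.suc i} {Fin.suc j} eq = cong Fin.suc (Unique⇒lookup-injective uniq eq)

-- Prefix letter counts and splicing of inputs

kronecker : ∀ {k} → Fin k → Fin k → ℕ
kronecker Fin.zero    Fin.zero    = 1
kronecker Fin.zero    (Fin.suc _) = 0
kronecker (Fin.suc _) Fin.zero    = 0
kronecker (Fin.suc a) (Fin.suc b) = kronecker a b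

kronecker-diag : ∀ {k} (a : Fin k) → kronecker a a ≡ 1
kronecker-diag Fin.zero    = refl
kronecker-diag (Fin.suc a) = kronecker-diag a

kronecker-≢ : ∀ {k} {a b : Fin k} → a ≢ b → kronecker a b ≡ 0
kronecker-≢ {a = Fin.zero}  {Fin.zero}  a≢b = ⊥-elim (a≢b refl)
kronecker-≢ {a = Fin.zero}  {Fin.suc _} _   = refl
kronecker-≢ {a = Fin.suc _} {Fin.zero}  _   = refl
kronecker-≢ {a = Fin.suc a} {Fin.suc b} a≢b = kronecker-≢ (a≢b ∘ cong Fin.suc)

sum-kronecker : ∀ {k} (a : Fin k) → sum (kronecker a) ≡ 1
sum-kronecker {suc k} Fin.zero    = cong suc (sum-replicate-zero k)
sum-kronecker {suc k} (Fin.suc a) = sum-kronecker a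

occ-∷ : ∀ {k n} (j a : Fin k) (xs : Vec (Fin k) n) → occ j (a ∷ xs) ≡ kronecker a j + occ j xs
occ-∷ j a xs with a Fin.≟ j
... | yes refl rewrite kronecker-diag a = refl
... | no  a≢j  rewrite kronecker-≢ a≢j  = refl

module _ {k n : ℕ} where

  prefixCount : Vec (Fin k) n → (i : ℕ) → .(i ≤ n) → Fin k → ℕ
  prefixCount x zero    _ j = 0
  prefixCount x (suc i) p j = prefixCount x i (ℕ.<⇒≤ p) j + kronecker (lookup x (fromℕ< p)) j

  sum-prefixCount : ∀ x i (p : i ≤ n) → sum (prefixCount x i p) ≡ i
  sum-prefixCount x zero    _ = sum-replicate-zero k
  sum-prefixCount x (suc i) p = begin
    sum (λ j → prefixCount x i p′ j + kronecker a j)  ≡⟨ ∑-distrib-+ (prefixCount x i p′) (kronecker a) ⟩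
    sum (prefixCount x i p′) + sum (kronecker a)       ≡⟨ cong₂ _+_ (sum-prefixCount x i p′) (sum-kronecker a) ⟩
    i + 1                                               ≡⟨ ℕ.+-comm i 1 ⟩
    suc i                                               ∎
    where
    open ≡-Reasoning
    p′ = ℕ.<⇒≤ p
    a = lookup x (fromℕ< p)

prefixCount-∷ : ∀ {k n} (a : Fin k) (xs : Vec (Fin k) n) i (p : i ≤ n) j →
                prefixCount (a ∷ xs) (suc i) (s≤s p) j ≡ kronecker a j + prefixCount xs i p j
prefixCount-∷ a xs zero    _ j = ℕ.+-comm 0 (kronecker a j)
prefixCount-∷ a xs (suc i) p j =
  trans (cong (_+ kronecker (lookup xs (fromℕ< p)) j) (prefixCount-∷ a xs i (ℕ.<⇒≤ p) j))
        (ℕ.+-assoc (kronecker a j) _ _)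

occ≡prefixCount : ∀ {k n} (x : Vec (Fin k) n) j → occ j x ≡ prefixCount x n ℕ.≤-refl j
occ≡prefixCount Vec.[] j = refl
occ≡prefixCount {n = suc n} (a ∷ xs) j = begin
  occ j (a ∷ xs)                          ≡⟨ occ-∷ j a xs ⟩
  kronecker a j + occ j xs                ≡⟨ cong (kronecker a j +_) (occ≡prefixCount xs j) ⟩
  kronecker a j + prefixCount xs n _ j    ≡⟨ prefixCount-∷ a xs n ℕ.≤-refl j ⟨
  prefixCount (a ∷ xs) (suc n) _ j        ∎
  where open ≡-Reasoning

module _ {k n : ℕ} where

  record AgreeBelow (i : ℕ) (x y : Vec (Fin k) n) : Set where
    field below : ∀ q → toℕ q < i → lookup x q ≡ lookup y q

  record AgreeFrom (i : ℕ) (x y : Vec (Fin k) n) : Set where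
    field from : ∀ q → i ≤ toℕ q → lookup x q ≡ lookup y q

  open AgreeBelow
  open AgreeFrom

  agreeBelow-pred : ∀ {i x y} → AgreeBelow (suc i) x y → AgreeBelow i x y
  agreeBelow-pred agree .below q q<i = agree .below q (ℕ.m<n⇒m<1+n q<i)

  agreeBelow-last : ∀ {i x y} → AgreeBelow (suc i) x y → (p : suc i ≤ n) → lookup x (fromℕ< p) ≡ lookup y (fromℕ< p)
  agreeBelow-last agree p = agree .below (fromℕ< p) (ℕ.≤-reflexive (cong suc (Fin.toℕ-fromℕ< p)))

  agreeFrom-at : ∀ {i ℓ x y} → AgreeFrom i x y → i ≤′ ℓ → (p : suc ℓ ≤ n) → lookup x (fromℕ< p) ≡ lookup y (fromℕ< p)
  agreeFrom-at {i} agree i≤′ℓ p = agree .from (fromℕ< p) (subst (i ≤_) (sym (Fin.toℕ-fromℕ< p)) (ℕ.≤′⇒≤ i≤′ℓ))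

  spliceAt : ℕ → Vec (Fin k) n → Vec (Fin k) n → Fin n → Fin k
  spliceAt i y x q = if does (toℕ q ℕ.<? i) then lookup y q else lookup x q

  splice : ℕ → Vec (Fin k) n → Vec (Fin k) n → Vec (Fin k) n
  splice i y x = tabulate (spliceAt i y x)

  splice-below : ∀ i y x → AgreeBelow i (splice i y x) y
  splice-below i y x .below q q<i
    rewrite Vec.lookup∘tabulate (spliceAt i y x) q | dec-true (toℕ q ℕ.<? i) q<i = refl

  splice-from : ∀ i y x → AgreeFrom i (splice i y x) x
  splice-from i y x .from q i≤q
    rewrite Vec.lookup∘tabulate (spliceAt i y x) q | dec-false (toℕ q ℕ.<? i) (ℕ.≤⇒≯ i≤q) = refl

  prefixCount-below : ∀ {x y} i → AgreeBelow i x y → (p : i ≤ n) → ∀ j → prefixCount x i p j ≡ prefixCount y i p j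
  prefixCount-below zero    _     _ _ = refl
  prefixCount-below (suc i) agree p j =
    cong₂ _+_ (prefixCount-below i (agreeBelow-pred agree) (ℕ.<⇒≤ p) j) (cong (λ a → kronecker a j) (agreeBelow-last agree p))

  prefixCount-from : ∀ {x y i ℓ} → AgreeFrom i x y → i ≤′ ℓ → (pᵢ : i ≤ n) (pℓ : ℓ ≤ n) → ∀ j →
                     prefixCount x ℓ pℓ j + prefixCount y i pᵢ j ≡ prefixCount y ℓ pℓ j + prefixCount x i pᵢ j
  prefixCount-from {x} {y} {i} agree ≤′-refl pᵢ pℓ j = ℕ.+-comm (prefixCount x i pℓ j) _
  prefixCount-from {x} {y} {i} {suc ℓ} agree (≤′-step i≤′ℓ) pᵢ pℓ j = begin
    Xℓ + κ x + Yᵢ  ≡⟨ xy∙z≈xz∙y Xℓ (κ x) Yᵢ ⟩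
    Xℓ + Yᵢ + κ x  ≡⟨ cong₂ _+_ (prefixCount-from agree i≤′ℓ pᵢ (ℕ.<⇒≤ pℓ) j) κx≡κy ⟩
    Yℓ + Xᵢ + κ y  ≡⟨ xy∙z≈xz∙y Yℓ Xᵢ (κ y) ⟩
    Yℓ + κ y + Xᵢ  ∎
    where
    open ≡-Reasoning
    Xℓ = prefixCount x ℓ (ℕ.<⇒≤ pℓ) j
    Yℓ = prefixCount y ℓ (ℕ.<⇒≤ pℓ) j
    Xᵢ = prefixCount x i pᵢ j
    Yᵢ = prefixCount y i pᵢ j
    κ : Vec (Fin k) n → ℕ
    κ z = kronecker (lookup z (fromℕ< pℓ)) j
    κx≡κy : κ x ≡ κ y
    κx≡κy = cong (λ a → kronecker a j) (agreeFrom-at agree i≤′ℓ pℓ)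

occ-splice : ∀ {k n} i (p : i ≤ n) (y x : Vec (Fin k) n) j →
             occ j (splice i y x) + prefixCount x i p j ≡ occ j x + prefixCount y i p j
occ-splice {n = n} i p y x j = begin
  occ j z + prefixCount x i p j                     ≡⟨ cong (_+ prefixCount x i p j) (occ≡prefixCount z j) ⟩
  prefixCount z n ℕ.≤-refl j + prefixCount x i p j  ≡⟨ prefixCount-from (splice-from i y x) (ℕ.≤⇒≤′ p) p ℕ.≤-refl j ⟩
  prefixCount x n ℕ.≤-refl j + prefixCount z i p j  ≡⟨ cong₂ _+_ (sym (occ≡prefixCount x j)) (prefixCount-below i (splice-below i y x) p j) ⟩
  occ j x + prefixCount y i p j                     ∎
  where
  open ≡-Reasoning
  z = splice i y x

module _ {k n : ℕ} (P : ROBP k n) where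
  open ROBP P

  state-irrelevant : ∀ x i (p q : i ≤ n) → state x i p ≡ state x i q
  state-irrelevant x i p q = cong (state x i) (ℕ.≤-irrelevant p q)

  state-below : ∀ {x y} i → AgreeBelow i x y → (p : i ≤ n) → state x i p ≡ state y i p
  state-below zero    _     _ = refl
  state-below (suc i) agree p = cong₂ (δ i p) (state-below i (agreeBelow-pred agree) (ℕ.<⇒≤ p)) (agreeBelow-last agree p)

  state-from : ∀ {x y i ℓ} → AgreeFrom i x y → i ≤′ ℓ → (pᵢ : i ≤ n) (pℓ : ℓ ≤ n) →
               state x i pᵢ ≡ state y i pᵢ → state x ℓ pℓ ≡ state y ℓ pℓ
  state-from {x} {y} {i} _ ≤′-refl pᵢ pℓ same =
    trans (state-irrelevant x i pℓ pᵢ) (trans same (state-irrelevant y i pᵢ pℓ))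
  state-from {ℓ = suc ℓ} agree (≤′-step i≤′ℓ) pᵢ pℓ same =
    cong₂ (δ ℓ pℓ) (state-from agree i≤′ℓ pᵢ (ℕ.<⇒≤ pℓ) same) (agreeFrom-at agree i≤′ℓ pℓ)

  run-splice : ∀ {x y} i (p : i ≤ n) → state x i p ≡ state y i p → run (splice i y x) ≡ run x
  run-splice {x} {y} i p same =
    cong out (state-from (splice-from i y x) (ℕ.≤⇒≤′ p) p ℕ.≤-refl (trans (state-below i (splice-below i y x) p) (sym same)))

PrefixCountsWithin : ∀ {k n} → ROBP k n → ℕ → Set
PrefixCountsWithin {k} {n} P t = ∀ x y i (p : i ≤ n) → ROBP.state P x i p ≡ ROBP.state P y i p →
                                 ∀ j → prefixCount x i p j ≤ prefixCount y i p j + t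

approxCount⇒prefixCountsWithin : ∀ {k n} {P : ROBP k n} {Δ t} → ComputesApproxCount P Δ →
                                 (∀ a b → ℕ→ℚ a ≤ℚ ℕ→ℚ b +ℚ (Δ +ℚ Δ) → a ≤ b + t) → PrefixCountsWithin P t
approxCount⇒prefixCountsWithin {P = P} {Δ} {t} computes integral x y i p same j =
  ℕ.+-cancelˡ-≤ (occ j x) _ _ (begin
    occ j x + prefixCount x i p j        ≤⟨ ℕ.+-monoˡ-≤ (prefixCount x i p j) occx≤occz+t ⟩
    occ j z + t + prefixCount x i p j    ≡⟨ xy∙z≈xz∙y (occ j z) t (prefixCount x i p j) ⟩
    occ j z + prefixCount x i p j + t    ≡⟨ cong (_+ t) (occ-splice i p y x j) ⟩
    occ j x + prefixCount y i p j + t    ≡⟨ ℕ.+-assoc (occ j x) (prefixCount y i p j) t ⟩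
    occ j x + (prefixCount y i p j + t)  ∎)
  where
  open ℕ.≤-Reasoning
  z = splice i y x
  occx≤occz+t : occ j x ≤ occ j z + t
  occx≤occz+t = integral (occ j x) (occ j z) (∣r-p∣≤Δ⇒∣r-q∣≤Δ⇒q≤p+[Δ+Δ] {ROBP.run P x j}
    (subst (λ r → ∣ r j -ℚ ℕ→ℚ (occ j z) ∣ ≤ℚ Δ) (run-splice P i p same) (computes z j)) (computes x j))

-- Vertices at which a count vector is minimal

module MinCounts {k′ n : ℕ} (P : ROBP (suc k′) n) {t : ℕ} (within : PrefixCountsWithin P t) where
  open ROBP P

  record Covers (i : ℕ) (p : i ≤ n) (v : Fin (layer i)) (d : Vec ℕ (suc k′)) : Set where
    field witness : ∀ j → ∃ λ x → state x i p ≡ v × prefixCount x i p j ≤ lookup d j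

  record IsMinCount (i : ℕ) (p : i ≤ n) (v : Fin (layer i)) (d : Vec ℕ (suc k′)) : Set where
    field
      covers : Covers i p v d
      lower  : ∀ x → state x i p ≡ v → ∀ j → lookup d j ≤ prefixCount x i p j

  open Covers
  open IsMinCount

  covers⇒layer≤ : ∀ {i p v d} → Covers i p v d → i ≤ sum (lookup d) + k′ * t
  covers⇒layer≤ {i} {p} {d = d₀ ∷ ds} cov with cov .witness Fin.zero
  ... | x₀ , x₀↦v , c₀ = begin
    i                                            ≡⟨ sum-prefixCount x₀ i p ⟨
    sum (prefixCount x₀ i p)                     ≤⟨ ℕ.+-mono-≤ c₀ (sum-mono-≤ (λ j → x₀-bound (Fin.suc j))) ⟩
    d₀ + sum (λ j → lookup ds j + t)             ≡⟨ cong (d₀ +_) (∑-distrib-+ (lookup ds) (λ _ → t)) ⟩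
    d₀ + (sum (lookup ds) + sum {k′} (λ _ → t))  ≡⟨ cong (λ s → d₀ + (sum (lookup ds) + s)) (sum-const k′ t) ⟩
    d₀ + (sum (lookup ds) + k′ * t)              ≡⟨ ℕ.+-assoc d₀ (sum (lookup ds)) (k′ * t) ⟨
    d₀ + sum (lookup ds) + k′ * t                ∎
    where
    open ℕ.≤-Reasoning
    x₀-bound : ∀ j → prefixCount x₀ i p j ≤ lookup (d₀ ∷ ds) j + t
    x₀-bound j with cov .witness j
    ... | x , x↦v , c = ℕ.≤-trans (within x₀ x i p (trans x₀↦v (sym x↦v)) j) (ℕ.+-monoˡ-≤ t c)

  isMinCount⇒sum≤layer : ∀ {i p v d} → IsMinCount i p v d → sum (lookup d) ≤ i
  isMinCount⇒sum≤layer {i} {p} {d = d} min with min .covers .witness Fin.zero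
  ... | x , x↦v , _ = begin
    sum (lookup d)          ≤⟨ sum-mono-≤ (min .lower x x↦v) ⟩
    sum (prefixCount x i p) ≡⟨ sum-prefixCount x i p ⟩
    i                       ∎
    where open ℕ.≤-Reasoning

  isMinCount≤covers : ∀ {i p v d d′} → IsMinCount i p v d → Covers i p v d′ → ∀ j → lookup d j ≤ lookup d′ j
  isMinCount≤covers min cov j with cov .witness j
  ... | x , x↦v , c = ℕ.≤-trans (min .lower x x↦v j) c

  isMinCount-unique : ∀ {i p v d d′} → IsMinCount i p v d → IsMinCount i p v d′ → d ≡ d′
  isMinCount-unique min min′ =
    lookup-extensionality λ j → ℕ.≤-antisym (isMinCount≤covers min (min′ .covers) j) (isMinCount≤covers min′ (min .covers) j)

  covers-step : ∀ {i v d} (p : i ≤ n) (q : i < n) → Covers i p v d → ∀ x j → state x i p ≡ v →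
                prefixCount x i p j < lookup d j → Covers (suc i) q (δ i q v j) d
  covers-step {i} {v} {d} p q cov x j x↦v below .witness j′ = x′ , x′↦δvj , x′-count
    where
    start : ∃ λ y → state y i p ≡ v × prefixCount y i p j′ + kronecker j j′ ≤ lookup d j′
    start with j Fin.≟ j′
    ... | yes refl rewrite kronecker-diag j = x , x↦v , subst (_≤ lookup d j) (ℕ.+-comm 1 _) below
    ... | no  j≢j′ rewrite kronecker-≢ j≢j′ with cov .witness j′
    ...   | y , y↦v , c = y , y↦v , subst (_≤ lookup d j′) (sym (ℕ.+-identityʳ _)) c
    y = proj₁ start
    x′ = splice i y (replicate n j)
    x′[i]≡j : lookup x′ (fromℕ< q) ≡ j
    x′[i]≡j = trans (agreeFrom-at (splice-from i y (replicate n j)) ≤′-refl q) (Vec.lookup-replicate (fromℕ< q) j)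
    x′↦δvj : state x′ (suc i) q ≡ δ i q v j
    x′↦δvj = cong₂ (δ i q)
      (trans (state-below P i (splice-below i y (replicate n j)) (ℕ.<⇒≤ q))
             (trans (state-irrelevant P y i (ℕ.<⇒≤ q) p) (proj₁ (proj₂ start))))
      x′[i]≡j
    x′-count : prefixCount x′ (suc i) q j′ ≤ lookup d j′
    x′-count = subst (_≤ lookup d j′)
      (sym (cong₂ _+_ (prefixCount-below i (splice-below i y (replicate n j)) p j′) (cong (λ a → kronecker a j′) x′[i]≡j)))
      (proj₂ (proj₂ start))

  MinCountVertex : Vec ℕ (suc k′) → Set
  MinCountVertex d = Σ ℕ λ i → Σ (i ≤ n) λ p → Σ (Fin (layer i)) λ v → IsMinCount i p v d

  module _ {d : Vec ℕ (suc k′)} (short : sum (lookup d) + k′ * t < n) where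

    walk : ∀ rest i (p : i ≤ n) v → rest + i ≡ n → Covers i p v d → MinCountVertex d
    walk rest i p v rest+i≡n cov
      with ∃-vec? (λ x → Fin.any? (λ j → (state x i p Fin.≟ v) ×-dec (prefixCount x i p j ℕ.<? lookup d j)))
    ... | no ¬improvable = i , p , v , record
      { covers = cov ; lower = λ x x↦v j → ℕ.≮⇒≥ (λ below → ¬improvable (x , j , x↦v , below)) }
    ... | yes (x , j , x↦v , below) = advance rest rest+i≡n
      where
      i<n : i < n
      i<n = ℕ.≤-<-trans (covers⇒layer≤ cov) short
      advance : ∀ rest → rest + i ≡ n → MinCountVertex d
      advance zero       i≡n        = ⊥-elim (ℕ.<-irrefl i≡n i<n)
      advance (suc rest) rest+1+i≡n =
        walk rest (suc i) i<n (δ i i<n v j) (trans (ℕ.+-suc rest i) rest+1+i≡n) (covers-step p i<n cov x j x↦v below)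

    minCountVertex : MinCountVertex d
    minCountVertex = walk n 0 z≤n Fin.zero (ℕ.+-identityʳ n) record { witness = λ _ → replicate n Fin.zero , refl , z≤n }

  module Counting {w : ℕ} (narrow : ∀ i → i ≤ n → layer i ≤ w) (m : ℕ) where

    Code : Set
    Code = Fin (length (vecsOfSum≤ (suc k′) m)) ⊎ (Fin (n ∸ m ∸ 1) × Fin w)

    laterLayer< : ∀ {i} → m < i → i < n → i ∸ suc m < n ∸ m ∸ 1
    laterLayer< {i} m<i i<n = subst (i ∸ suc m <_) n∸[1+m]≡n∸m∸1 (ℕ.∸-monoˡ-< i<n m<i)
      where
      n∸[1+m]≡n∸m∸1 : n ∸ suc m ≡ n ∸ m ∸ 1
      n∸[1+m]≡n∸m∸1 = trans (cong (n ∸_) (ℕ.+-comm 1 m)) (sym (ℕ.∸-+-assoc n m 1))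

    code : ∀ d → sum (lookup d) + k′ * t < n → MinCountVertex d → Code
    code d short (i , p , v , min) with i ℕ.≤? m
    ... | yes i≤m = inj₁ (Any.index (∈-vecsOfSum≤⁺ (suc k′) m d (ℕ.≤-trans (isMinCount⇒sum≤layer min) i≤m)))
    ... | no  i≰m = inj₂ ( fromℕ< (laterLayer< (ℕ.≰⇒> i≰m) (ℕ.≤-<-trans (covers⇒layer≤ (min .covers)) short))
                         , Fin.inject≤ v (narrow i p))

    code-injective : ∀ {d d′ s s′} R R′ → code d s R ≡ code d′ s′ R′ → d ≡ d′
    code-injective {d} {d′} (i , p , v , min) (i′ , p′ , v′ , min′) eq with i ℕ.≤? m | i′ ℕ.≤? m
    ... | yes _ | yes _ = Membership.index-injective (setoid _) _ _ (inj₁-injective eq)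
    ... | yes _ | no  _ = ⊥-elim (case eq of λ ())
    ... | no  _ | yes _ = ⊥-elim (case eq of λ ())
    ... | no i≰m | no i′≰m with ,-injective (inj₂-injective eq)
    ...   | layer-eq , vertex-eq
          with refl ← ℕ.∸-cancelʳ-≡ (ℕ.≰⇒> i≰m) (ℕ.≰⇒> i′≰m) (Fin.fromℕ<-injective _ _ _ _ layer-eq)
          rewrite ℕ.≤-irrelevant p p′ | Fin.inject≤-injective _ _ v v′ vertex-eq = isMinCount-unique min min′

    vecsOfSum≤-count : ∀ N → N + k′ * t < n → (N + suc k′) C suc k′ ≤ (m + suc k′) C suc k′ + (n ∸ m ∸ 1) * w
    vecsOfSum≤-count N short =
      subst₂ (λ a b → a ≤ b + (n ∸ m ∸ 1) * w) (length-vecsOfSum≤ (suc k′) N) (length-vecsOfSum≤ (suc k′) m)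
        (Fin.injective⇒≤ encode-injective)
      where
      d : Fin (length (vecsOfSum≤ (suc k′) N)) → Vec ℕ (suc k′)
      d = List.lookup (vecsOfSum≤ (suc k′) N)
      short-d : ∀ r → sum (lookup (d r)) + k′ * t < n
      short-d r = ℕ.≤-<-trans (ℕ.+-monoˡ-≤ (k′ * t) (∈-vecsOfSum≤⁻ (suc k′) N (∈-lookup r))) short
      encode : Fin (length (vecsOfSum≤ (suc k′) N)) → Fin (length (vecsOfSum≤ (suc k′) m) + (n ∸ m ∸ 1) * w)
      encode r = Inverse.to Fin⊎Fin×Fin↔Fin (code (d r) (short-d r) (minCountVertex (short-d r)))
      encode-injective : ∀ {r r′} → encode r ≡ encode r′ → r ≡ r′
      encode-injective {r} {r′} eq = Unique⇒lookup-injective (vecsOfSum≤-unique (suc k′) N)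
        (code-injective (minCountVertex (short-d r)) (minCountVertex (short-d r′)) (Injection.injective (↔⇒↣ Fin⊎Fin×Fin↔Fin) eq))

    count-bound : (n ∸ k′ * t + k′) C suc k′ ≤ (m + suc k′) C suc k′ + (n ∸ m ∸ 1) * w
    count-bound with n ∸ k′ * t in n∸T≡
    ... | zero  rewrite k>n⇒nCk≡0 (ℕ.n<1+n k′) = z≤n
    ... | suc N = subst (_≤ _) (cong (_C suc k′) (ℕ.+-suc N k′)) (vecsOfSum≤-count N N+T<n)
      where
      T≤n : k′ * t ≤ n
      T≤n = ℕ.<⇒≤ (ℕ.m∸n≢0⇒n<m (λ n∸T≡0 → ℕ.0≢1+n (trans (sym n∸T≡0) n∸T≡)))
      N+T<n : N + k′ * t < n
      N+T<n = subst (N + k′ * t <_) (trans (cong (_+ k′ * t) (sym n∸T≡)) (ℕ.m∸n+n≡m T≤n)) ℕ.≤-refl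

theorem4p1 : (k n w : ℕ) → 2 ≤ k → 1 ≤ n → 1 ≤ w →
    (Δ : ℚ) → 0ℚ ≤ℚ Δ → ℕ→ℚ (2 * (k ∸ 1)) *ℚ Δ ≤ℚ ℕ→ℚ n →
    (P : ROBP k n) → ROBP.AllReachable P → ROBP.HasWidth P w →
    ComputesApproxCount P Δ →
    (m : ℕ) → m ≤ n ∸ 1 → (m + k ∸ 1) C (k ∸ 1) ≤ w →
    ((m′ : ℕ) → m′ ≤ n ∸ 1 → (m′ + k ∸ 1) C (k ∸ 1) ≤ w → m′ ≤ m) →
    binomℚ (ℕ→ℚ n -ℚ ℕ→ℚ (2 * (k ∸ 1)) *ℚ Δ +ℚ ℕ→ℚ (k ∸ 1)) k
      ≤ℚ ℕ→ℚ ((m + k) C k + (n ∸ m ∸ 1) * w)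
theorem4p1 (suc k′) n w _ _ _ Δ 0≤Δ 2k′Δ≤n P _ (narrow , _) computes m _ _ _ = begin
  binomℚ (ℕ→ℚ n -ℚ ℕ→ℚ (2 * k′) *ℚ Δ +ℚ ℕ→ℚ k′) (suc k′)
    ≤⟨ binomℚ[n-D+K]≤[n∸T+K]C[1+K] n k′ (k′ * ⌊q⌋) (ℕ→ℚ[k*t]≤ℕ→ℚ[2*k]*Δ k′ ⌊q⌋≤q) 2k′Δ≤n ⟩
  ℕ→ℚ ((n ∸ k′ * ⌊q⌋ + k′) C suc k′)
    ≤⟨ ℕ→ℚ-mono-≤ count-bound ⟩
  ℕ→ℚ ((m + suc k′) C suc k′ + (n ∸ m ∸ 1) * w)
    ∎
  where
  open ℚ.≤-Reasoning
  open NatFloor (natFloor (Δ +ℚ Δ) (ℚ.+-mono-≤ 0≤Δ 0≤Δ))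
  open MinCounts P (approxCount⇒prefixCountsWithin computes ≤+⌊q⌋)
  open Counting narrow m
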